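{- Let $\vdash$ be a finitary logic satisfying the standing assumption below, suppose $\vdash$ has no antitheorems, and suppose $\vdash\neq\vdash^{r}$ and $\vdash\neq\vdash^{l}$. Then: (i) $\vdash^{l}\not\leq\vdash^{r}$ and $\vdash^{r}\not\leq\vdash^{l}$; (ii) $\vdash^{l}\cap\vdash^{r}=\vdash^{lr}$, and $\vdash^{lr}$ is strictly below both $\vdash^{l}$ and $\vdash^{r}$ (i.e. $\vdash^{lr}\leq\vdash^{l}$, $\vdash^{lr}\leq\vdash^r$, and $\vdash^{lr}\neq\vdash^{l}$, $\vdash^{lr}\neq\vdash^{r}$); (iii) $\vdash^{rl}=\vdash^{rl\bullet}=\vdash^{lrl\bullet}$ for every finite (possibly empty) sequence $\bullet$ over $\{l,r\}$.
   Context: Fix an algebraic language and let $Fm$ be the set of formulas built over a countably infinite set $\mathrm{Var}$ of variables. For a formula $\varphi$, $\mathrm{Var}(\varphi)$ is the set of variables occurring in $\varphi$, and for $\Gamma\subseteq Fm$, $\mathrm{Var}(\Gamma)=\bigcup_{\gamma\in\Gamma}\mathrm{Var}(\gamma)$. A logic is a consequence relation $\vdash\subseteq\mathcal{P}(Fm)\times Fm$ invariant under substitutions; it is finitary if $\Gamma\vdash\varphi$ iff $\Delta\vdash\varphi$ for some finite $\Delta\subseteq\Gamma$. Logics are identified with subsets of $\mathcal{P}(Fm)\times Fm$; $\vdash'\leq\vdash''$ means $\vdash'\subseteq\vdash''$, and $\cap$ is intersection (the meet in the lattice of logics). A set $\Sigma$ of formulas is an antitheorem of $\vdash$ if $\sigma[\Sigma]\vdash\varphi$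 for every substitution $\sigma$ and every formula $\varphi$. For a logic $\vdash$: $\Gamma\vdash^{l}\varphi$ iff there is $\Delta\subseteq\Gamma$ with $\mathrm{Var}(\Delta)\subseteq\mathrm{Var}(\varphi)$ and $\Delta\vdash\varphi$; $\Gamma\vdash^{r}\varphi$ iff either ($\Gamma\vdash\varphi$ and $\mathrm{Var}(\varphi)\subseteq\mathrm{Var}(\Gamma)$) or $\Sigma\subseteq\Gamma$ for some antitheorem $\Sigma$ of $\vdash$. For a finite sequence $u_1\dots u_n$ over $\{l,r\}$, $\vdash^{u_1\dots u_n}$ is the result of applying the operation $u_n$ to $\vdash^{u_1\dots u_{n-1}}$ (the empty sequence gives $\vdash$); juxtaposition denotes concatenation of sequences. Standing assumption: $\vdash$ is finitary and there is a binary formula $\pi(x,y)$, in which $x$ and $y$ really occur, that is an $l$-partition function for $\vdash^l$ and an $r$-partition function for $\vdash^r$. Here: for a logic $\vdash'$, $\mathrm{Alg}(\vdash')$ is the class of algebraic reducts of the reduced matrix models of $\vdash'$; a binary operation $\cdot$ on an algebra is a partition function if for all $a,b,c$ and every basic operation $g$ of arity $n\ge1$: $a\cdot a=a$; $a\cdot(b\cdot c)=(a\cdot b)\cdot c$; $a\cdot(b\cdot c)=a\cdot(c\cdot b)$; $g(a_1,\dots,a_n)\cdot b=g(a_1\cdot b,\dots,a_n\cdot b)$; $b\cdot g(a_1,\dots,a_n)=b\cdot a_1\cdot\ldots\cdot a_n$. A formula $x\cdot y$ is an $l$-partition function for $\vdash'$ if $x\vdash' x\cdot y$ and these five conditions hold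 as equations in every algebra of $\mathrm{Alg}(\vdash')$; a formula $x\ast y$ is an $r$-partition function for $\vdash'$ if $x,y\vdash' x\ast y$, $x\ast y\vdash' x$, and $\ast$ is a partition function in every algebra of $\mathrm{Alg}(\vdash')$. -}

module Defs where

open import Data.Nat using (ℕ; zero; suc; _≤_)
open import Data.Fin using (Fin; zero; suc)
open import Data.List using (List; []; _∷_)
open import Data.List.Membership.Propositional using (_∈_)
open import Data.Product using (Σ; _×_; _,_; ∃)
open import Data.Sum using (_⊎_)
open import Relation.Nullary using (¬_)
open import Relation.Binary.PropositionalEquality using (_≡_)
open import Relation.Binary.Structures using (IsEquivalence)

record Signature : Set₁ where
  field
    Op    : Set
    arity : Op → ℕ

data LR : Set where
  l r : LR

module Logics (L : Signature) where
  open Signature L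

  data Fm : Set where
    var : ℕ → Fm
    op  : (f : Op) → (Fin (arity f) → Fm) → Fm

  FmSet : Set₁
  FmSet = Fm → Set

  _⊆_ : FmSet → FmSet → Set
  Γ ⊆ Δ = ∀ φ → Γ φ → Δ φ

  data Occurs (x : ℕ) : Fm → Set where
    here  : Occurs x (var x)
    below : ∀ {f ts} (i : Fin (arity f)) → Occurs x (ts i) → Occurs x (op f ts)

  OccursIn : ℕ → FmSet → Set
  OccursIn x Γ = Σ Fm λ γ → Γ γ × Occurs x γ

  VarsSetIn : FmSet → Fm → Set
  VarsSetIn Γ φ = ∀ x → OccursIn x Γ → Occurs x φ

  VarsIn : Fm → FmSet → Set
  VarsIn φ Γ = ∀ x → Occurs x φ → OccursIn x Γ

  Subst : Set
  Subst = ℕ → Fm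

  _⟨_⟩ : Fm → Subst → Fm
  var x    ⟨ σ ⟩ = σ x
  op f ts  ⟨ σ ⟩ = op f (λ i → ts i ⟨ σ ⟩)

  image : Subst → FmSet → FmSet
  image σ Γ ψ = Σ Fm λ γ → Γ γ × (ψ ≡ γ ⟨ σ ⟩)

  Logic : Set₂
  Logic = FmSet → Fm → Set₁

  record IsLogic (⊢ : Logic) : Set₁ where
    field
      reflexive  : ∀ Γ φ → Γ φ → ⊢ Γ φ
      monotone   : ∀ Γ Δ φ → Γ ⊆ Δ → ⊢ Γ φ → ⊢ Δ φ
      cut        : ∀ Γ Δ φ → (∀ δ → Δ δ → ⊢ Γ δ) → ⊢ Δ φ → ⊢ Γ φ
      structural : ∀ Γ φ (σ : Subst) → ⊢ Γ φ → ⊢ (image σ Γ) (φ ⟨ σ ⟩)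

  listSet : List Fm → FmSet
  listSet ds ψ = ψ ∈ ds

  Finitary : Logic → Set₁
  Finitary ⊢ = ∀ Γ φ → (⊢ Γ φ → Σ (List Fm) λ ds → listSet ds ⊆ Γ × ⊢ (listSet ds) φ)
                     × ((Σ (List Fm) λ ds → listSet ds ⊆ Γ × ⊢ (listSet ds) φ) → ⊢ Γ φ)

  _≤ᴸ_ : Logic → Logic → Set₁
  ⊢₁ ≤ᴸ ⊢₂ = ∀ Γ φ → ⊢₁ Γ φ → ⊢₂ Γ φ

  _≈ᴸ_ : Logic → Logic → Set₁
  ⊢₁ ≈ᴸ ⊢₂ = (⊢₁ ≤ᴸ ⊢₂) × (⊢₂ ≤ᴸ ⊢₁)

  _∩ᴸ_ : Logic → Logic → Logic
  (⊢₁ ∩ᴸ ⊢₂) Γ φ = ⊢₁ Γ φ × ⊢₂ Γ φ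

  IsAntitheorem : Logic → FmSet → Set₁
  IsAntitheorem ⊢ S = ∀ (σ : Subst) φ → ⊢ (image σ S) φ

  NoAntitheorems : Logic → Set₁
  NoAntitheorems ⊢ = ∀ S → ¬ IsAntitheorem ⊢ S

  lOp : Logic → Logic
  lOp ⊢ Γ φ = Σ FmSet λ Δ → Δ ⊆ Γ × VarsSetIn Δ φ × ⊢ Δ φ

  rOp : Logic → Logic
  rOp ⊢ Γ φ = (⊢ Γ φ × VarsIn φ Γ) ⊎ (Σ FmSet λ S → IsAntitheorem ⊢ S × S ⊆ Γ)

  applyLR : LR → Logic → Logic
  applyLR l = lOp
  applyLR r = rOp

  -- ⊢^{u₁…uₙ}: apply u₁ first, then u₂, …, then uₙ
  _^_ : Logic → List LR → Logic
  ⊢ ^ []       = ⊢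
  ⊢ ^ (u ∷ us) = applyLR u ⊢ ^ us

  record Algebra : Set₁ where
    field
      Carrier : Set
      ops     : (f : Op) → (Fin (arity f) → Carrier) → Carrier

  module _ (A : Algebra) where
    open Algebra A

    ⟦_⟧ : Fm → (ℕ → Carrier) → Carrier
    ⟦ var x ⟧ h   = h x
    ⟦ op f ts ⟧ h = ops f (λ i → ⟦ ts i ⟧ h)

    IsModel : Logic → (Carrier → Set) → Set₁
    IsModel ⊢ F = ∀ Γ φ → ⊢ Γ φ → ∀ (h : ℕ → Carrier) →
                  (∀ γ → Γ γ → F (⟦ γ ⟧ h)) → F (⟦ φ ⟧ h)

    IsCongruence : (Carrier → Carrier → Set) → Set
    IsCongruence θ = IsEquivalence θ ×
      (∀ f (as bs : Fin (arity f) → Carrier) → (∀ i → θ (as i) (bs i)) → θ (ops f as) (ops f bs))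

    Compatible : (Carrier → Carrier → Set) → (Carrier → Set) → Set
    Compatible θ F = ∀ a b → θ a b → F a → F b

    -- (A, F) is reduced: its Leibniz congruence (the largest congruence
    -- compatible with F) is the identity
    IsReduced : (Carrier → Set) → Set₁
    IsReduced F = ∀ (θ : Carrier → Carrier → Set) → IsCongruence θ → Compatible θ F →
                  ∀ a b → θ a b → a ≡ b

  InAlg : Logic → Algebra → Set₁
  InAlg ⊢ A = Σ (Algebra.Carrier A → Set) λ F → IsModel A ⊢ F × IsReduced A F

  vx vy : Fm
  vx = var 0
  vy = var 1

  binop : Fm → (A : Algebra) → Algebra.Carrier A → Algebra.Carrier A → Algebra.Carrier A
  binop π A a b = ⟦_⟧ A π val
    where
      val : ℕ → Algebra.Carrier A
      val zero          = a
      val (suc zero)    = b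
      val (suc (suc _)) = a

  mulAll : {C : Set} → (C → C → C) → (n : ℕ) → C → (Fin n → C) → C
  mulAll _·_ zero    b as = b
  mulAll _·_ (suc n) b as = mulAll _·_ n (b · as zero) (λ i → as (suc i))

  IsPartitionFunction : (A : Algebra) → (Algebra.Carrier A → Algebra.Carrier A → Algebra.Carrier A) → Set
  IsPartitionFunction A _·_ =
    (∀ a → a · a ≡ a) ×
    (∀ a b c → a · (b · c) ≡ (a · b) · c) ×
    (∀ a b c → a · (b · c) ≡ a · (c · b)) ×
    (∀ (g : Op) → 1 ≤ arity g → ∀ (as : Fin (arity g) → Algebra.Carrier A) b →
        ops g as · b ≡ ops g (λ i → as i · b)) ×
    (∀ (g : Op) → 1 ≤ arity g → ∀ (as : Fin (arity g) → Algebra.Carrier A) b →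
        b · ops g as ≡ mulAll _·_ (arity g) b as)
    where open Algebra A

  singleton : Fm → FmSet
  singleton φ ψ = ψ ≡ φ

  pair : Fm → Fm → FmSet
  pair φ χ ψ = (ψ ≡ φ) ⊎ (ψ ≡ χ)

  IsLPartition : Logic → Fm → Set₁
  IsLPartition ⊢ π = ⊢ (singleton vx) π ×
    (∀ A → InAlg ⊢ A → IsPartitionFunction A (binop π A))

  IsRPartition : Logic → Fm → Set₁
  IsRPartition ⊢ π = ⊢ (pair vx vy) π × ⊢ (singleton π) vx ×
    (∀ A → InAlg ⊢ A → IsPartitionFunction A (binop π A))

  IsBinaryFormula : Fm → Set
  IsBinaryFormula π = Occurs 0 π × Occurs 1 π × (∀ z → Occurs z π → (z ≡ 0) ⊎ (z ≡ 1))

  StandingAssumption : Logic → Set₁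
  StandingAssumption ⊢ = Finitary ⊢ × Σ Fm λ π → IsBinaryFormula π ×
    IsLPartition (lOp ⊢) π × IsRPartition (rOp ⊢) π

-- Without antitheorems, ⊢ʳ is ⊢ restricted to inferences whose conclusion has no variable outside
-- the premises, and ⊢ˡ keeps the inferences that follow from premises with no variable outside
-- the conclusion; both only shrink ⊢. Hence ⊢ʳˡ introduces no variables, so r fixes it, and l is
-- idempotent, so every further operation leaves ⊢ʳˡ unchanged; and ⊢ˡʳˡ = ⊢ʳˡ because an
-- inference of ⊢ʳˡ has premises with exactly the variables of its conclusion, hence lies in ⊢ˡ.
-- The partition function separates ⊢ˡ from ⊢ʳ: x ⊢ˡ π(x,y) introduces y, and if π(x,y) ⊢ʳ x
-- were in ⊢ˡ then x would follow from no premises, making the empty set an antitheorem.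
module Submission where

open import Defs
open import Data.List using (List; []; _∷_)
open import Data.Nat using (ℕ)
open import Data.Product using (Σ; _×_; _,_; proj₁; proj₂)
open import Data.Sum using (inj₁; inj₂)
open import Data.Empty using (⊥-elim)
open import Relation.Nullary using (¬_)
open import Relation.Binary.PropositionalEquality using (_≡_; _≢_; refl)

module LogicOperators (L : Signature) where
  open Logics L

  private variable
    ⊢ K M : Logic
    Γ : FmSet
    φ : Fm

  ≤ᴸ-refl : K ≤ᴸ K
  ≤ᴸ-refl Γ φ d = d

  ≤ᴸ-trans : K ≤ᴸ M → M ≤ᴸ ⊢ → K ≤ᴸ ⊢
  ≤ᴸ-trans p q Γ φ d = q Γ φ (p Γ φ d)

  ≈ᴸ-refl : K ≈ᴸ K
  ≈ᴸ-refl = ≤ᴸ-refl , ≤ᴸ-refl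

  ≈ᴸ-sym : K ≈ᴸ M → M ≈ᴸ K
  ≈ᴸ-sym (p , q) = q , p

  ≈ᴸ-trans : K ≈ᴸ M → M ≈ᴸ ⊢ → K ≈ᴸ ⊢
  ≈ᴸ-trans (p , q) (p′ , q′) = ≤ᴸ-trans p p′ , ≤ᴸ-trans q′ q

  Occurs-var : ∀ {z x} → Occurs z (var x) → z ≡ x
  Occurs-var here = refl

  NoAntitheorems-antitone : K ≤ᴸ M → NoAntitheorems M → NoAntitheorems K
  NoAntitheorems-antitone K≤M noM S anti = noM S (λ σ φ → K≤M _ φ (anti σ φ))

  VarsPreserving : Logic → Set₁
  VarsPreserving K = ∀ Γ φ → K Γ φ → VarsIn φ Γ

  lOp-mono : K ≤ᴸ M → lOp K ≤ᴸ lOp M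
  lOp-mono K≤M Γ φ (Δ , Δ⊆Γ , vars , d) = Δ , Δ⊆Γ , vars , K≤M Δ φ d

  rOp-mono : K ≤ᴸ M → rOp K ≤ᴸ rOp M
  rOp-mono K≤M Γ φ (inj₁ (d , vars))     = inj₁ (K≤M Γ φ d , vars)
  rOp-mono K≤M Γ φ (inj₂ (S , anti , S⊆Γ)) = inj₂ (S , (λ σ ψ → K≤M _ ψ (anti σ ψ)) , S⊆Γ)

  lOp-cong : K ≈ᴸ M → lOp K ≈ᴸ lOp M
  lOp-cong (p , q) = lOp-mono p , lOp-mono q

  rOp-cong : K ≈ᴸ M → rOp K ≈ᴸ rOp M
  rOp-cong (p , q) = rOp-mono p , rOp-mono q

  lOp-idempotent : lOp (lOp K) ≈ᴸ lOp K
  lOp-idempotent =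
    (λ { Γ φ (Δ′ , Δ′⊆Γ , _ , (Δ , Δ⊆Δ′ , vars , d)) →
           Δ , (λ ψ Δψ → Δ′⊆Γ ψ (Δ⊆Δ′ ψ Δψ)) , vars , d })
    , (λ { Γ φ (Δ , Δ⊆Γ , vars , d) → Δ , Δ⊆Γ , vars , (Δ , (λ ψ Δψ → Δψ) , vars , d) })

  lOp-deflationary : IsLogic ⊢ → lOp ⊢ ≤ᴸ ⊢
  lOp-deflationary isL Γ φ (Δ , Δ⊆Γ , _ , d) = IsLogic.monotone isL Δ Γ φ Δ⊆Γ d

  rOp-elim : ∀ K → NoAntitheorems K → ∀ Γ φ → rOp K Γ φ → K Γ φ × VarsIn φ Γ
  rOp-elim K noK Γ φ (inj₁ d)             = d
  rOp-elim K noK Γ φ (inj₂ (S , anti , _)) = ⊥-elim (noK S anti)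

  rOp-deflationary : NoAntitheorems K → rOp K ≤ᴸ K
  rOp-deflationary {K} noK Γ φ d = proj₁ (rOp-elim K noK Γ φ d)

  rOp-varsPreserving : ∀ K → NoAntitheorems K → VarsPreserving (rOp K)
  rOp-varsPreserving K noK Γ φ d = proj₂ (rOp-elim K noK Γ φ d)

  lOp-varsPreserving : VarsPreserving K → VarsPreserving (lOp K)
  lOp-varsPreserving pres Γ φ (Δ , Δ⊆Γ , _ , d) z zφ
    with pres Δ φ d z zφ
  ... | γ , Δγ , zγ = γ , Δ⊆Γ γ Δγ , zγ

  rOp-fixed : NoAntitheorems K → VarsPreserving K → rOp K ≈ᴸ K
  rOp-fixed noK pres = rOp-deflationary noK , λ Γ φ d → inj₁ (d , pres Γ φ d)

  ∩-≤-rOp-lOp : NoAntitheorems ⊢ → (lOp ⊢ ∩ᴸ rOp ⊢) ≤ᴸ rOp (lOp ⊢)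
  ∩-≤-rOp-lOp {⊢} no⊢ Γ φ (dˡ , dʳ) = inj₁ (dˡ , rOp-varsPreserving ⊢ no⊢ Γ φ dʳ)

  rOp-lOp-≤-∩ : lOp ⊢ ≤ᴸ ⊢ → NoAntitheorems ⊢ → rOp (lOp ⊢) ≤ᴸ (lOp ⊢ ∩ᴸ rOp ⊢)
  rOp-lOp-≤-∩ {⊢} l≤ no⊢ Γ φ d with rOp-elim (lOp ⊢) (NoAntitheorems-antitone l≤ no⊢) Γ φ d
  ... | dˡ , vars = dˡ , inj₁ (l≤ Γ φ dˡ , vars)

  lOp-rOp-lOp≈lOp-rOp : lOp ⊢ ≤ᴸ ⊢ → NoAntitheorems ⊢ → lOp (rOp (lOp ⊢)) ≈ᴸ lOp (rOp ⊢)
  lOp-rOp-lOp≈lOp-rOp {⊢} l≤ no⊢ =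
    lOp-mono (rOp-mono l≤)
    , λ { Γ φ (Δ , Δ⊆Γ , vars , d) →
            Δ , Δ⊆Γ , vars
            , ∩-≤-rOp-lOp no⊢ Δ φ ((Δ , (λ ψ Δψ → Δψ) , vars , proj₁ (rOp-elim ⊢ no⊢ Δ φ d)) , d) }

  rOp-lOp-rOp≈lOp-rOp : IsLogic ⊢ → NoAntitheorems ⊢ → rOp (lOp (rOp ⊢)) ≈ᴸ lOp (rOp ⊢)
  rOp-lOp-rOp≈lOp-rOp {⊢} isL no⊢ =
    rOp-fixed (NoAntitheorems-antitone rl≤ no⊢) (lOp-varsPreserving (rOp-varsPreserving ⊢ no⊢))
    where
    rl≤ : lOp (rOp ⊢) ≤ᴸ ⊢
    rl≤ = ≤ᴸ-trans (lOp-mono (rOp-deflationary no⊢)) (lOp-deflationary isL)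

  ^-fixed : lOp M ≈ᴸ M → rOp M ≈ᴸ M → K ≈ᴸ M → ∀ s → (K ^ s) ≈ᴸ M
  ^-fixed lM rM K≈M []      = K≈M
  ^-fixed lM rM K≈M (l ∷ s) = ^-fixed lM rM (≈ᴸ-trans (lOp-cong K≈M) lM) s
  ^-fixed lM rM K≈M (r ∷ s) = ^-fixed lM rM (≈ᴸ-trans (rOp-cong K≈M) rM) s

  ≰-rOp : NoAntitheorems ⊢ → K Γ φ → ¬ VarsIn φ Γ → ¬ (K ≤ᴸ rOp ⊢)
  ≰-rOp {⊢} no⊢ d newVar K≤r = newVar (rOp-varsPreserving ⊢ no⊢ _ _ (K≤r _ _ d))

  varTheorem⇒antitheorem : IsLogic ⊢ → ∀ {Δ x} → (∀ δ → ¬ Δ δ) → ⊢ Δ (var x) → IsAntitheorem ⊢ Δ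
  varTheorem⇒antitheorem isL {Δ} Δ-empty d σ φ =
    monotone _ _ φ (λ { ψ (δ , Δδ , _) → ⊥-elim (Δ-empty δ Δδ) }) (structural Δ _ (λ _ → φ) d)
    where open IsLogic isL

  ≰-lOp : IsLogic ⊢ → NoAntitheorems ⊢ → ∀ {x} → K Γ (var x) →
          (∀ γ → Γ γ → Σ ℕ λ z → Occurs z γ × z ≢ x) → ¬ (K ≤ᴸ lOp ⊢)
  ≰-lOp isL no⊢ d dropsVar K≤l with K≤l _ _ d
  ... | Δ , Δ⊆Γ , vars , dΔ = no⊢ Δ (varTheorem⇒antitheorem isL Δ-empty dΔ)
    where
    Δ-empty : ∀ δ → ¬ Δ δ
    Δ-empty δ Δδ with dropsVar δ (Δ⊆Γ δ Δδ)
    ... | z , zδ , z≢x = z≢x (Occurs-var (vars z (δ , Δδ , zδ)))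

theorem4p4 : (L : Signature) → let open Logics L in
    (⊢ : Logic) → IsLogic ⊢ → Finitary ⊢ → StandingAssumption ⊢ →
    NoAntitheorems ⊢ → ¬ (⊢ ≈ᴸ (⊢ ^ (r ∷ []))) → ¬ (⊢ ≈ᴸ (⊢ ^ (l ∷ []))) →
    -- (i)
    (¬ ((⊢ ^ (l ∷ [])) ≤ᴸ (⊢ ^ (r ∷ []))) × ¬ ((⊢ ^ (r ∷ [])) ≤ᴸ (⊢ ^ (l ∷ []))))
    -- (ii)
    × ((((⊢ ^ (l ∷ [])) ∩ᴸ (⊢ ^ (r ∷ []))) ≈ᴸ (⊢ ^ (l ∷ r ∷ [])))
       × ((⊢ ^ (l ∷ r ∷ [])) ≤ᴸ (⊢ ^ (l ∷ [])))
       × ((⊢ ^ (l ∷ r ∷ [])) ≤ᴸ (⊢ ^ (r ∷ [])))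
       × ¬ ((⊢ ^ (l ∷ r ∷ [])) ≈ᴸ (⊢ ^ (l ∷ [])))
       × ¬ ((⊢ ^ (l ∷ r ∷ [])) ≈ᴸ (⊢ ^ (r ∷ []))))
    -- (iii)
    × (∀ (s : List LR) → ((⊢ ^ (r ∷ l ∷ [])) ≈ᴸ (⊢ ^ (r ∷ l ∷ s)))
                       × ((⊢ ^ (r ∷ l ∷ s)) ≈ᴸ (⊢ ^ (l ∷ r ∷ l ∷ s))))
theorem4p4 L ⊢ isL _ (_ , π , (_ , y∈π , _) , (x⊢ˡπ , _) , (_ , π⊢ʳx , _)) no⊢ _ _ =
  (l≰r , r≰l) , (∩≈lr , lr≤l , lr≤r , (λ (_ , l≤lr) → l≰r (≤ᴸ-trans l≤lr lr≤r))
                                    , (λ (_ , r≤lr) → r≰l (≤ᴸ-trans r≤lr lr≤l)))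
  , λ s → ≈ᴸ-sym (stable (lOp (rOp ⊢)) ≈ᴸ-refl s)
        , ≈ᴸ-trans (stable (lOp (rOp ⊢)) ≈ᴸ-refl s)
                   (≈ᴸ-sym (stable (lOp (rOp (lOp ⊢))) (lOp-rOp-lOp≈lOp-rOp l≤ no⊢) s))
  where
  open Logics L
  open LogicOperators L

  l≤ : lOp ⊢ ≤ᴸ ⊢
  l≤ = lOp-deflationary isL

  l≰r : ¬ (lOp ⊢ ≤ᴸ rOp ⊢)
  l≰r = ≰-rOp no⊢ x⊢ˡπ λ vars → y∉Var-x (vars 1 y∈π)
    where
    y∉Var-x : ¬ OccursIn 1 (singleton vx)
    y∉Var-x (_ , refl , ())

  r≰l : ¬ (rOp ⊢ ≤ᴸ lOp ⊢)
  r≰l = ≰-lOp isL no⊢ π⊢ʳx λ { _ refl → 1 , y∈π , λ () }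

  ∩≈lr : (lOp ⊢ ∩ᴸ rOp ⊢) ≈ᴸ rOp (lOp ⊢)
  ∩≈lr = ∩-≤-rOp-lOp no⊢ , rOp-lOp-≤-∩ l≤ no⊢

  lr≤l : rOp (lOp ⊢) ≤ᴸ lOp ⊢
  lr≤l Γ φ d = proj₁ (proj₂ ∩≈lr Γ φ d)

  lr≤r : rOp (lOp ⊢) ≤ᴸ rOp ⊢
  lr≤r Γ φ d = proj₂ (proj₂ ∩≈lr Γ φ d)

  stable : ∀ K → K ≈ᴸ lOp (rOp ⊢) → ∀ s → (K ^ s) ≈ᴸ lOp (rOp ⊢)
  stable K = ^-fixed lOp-idempotent (rOp-lOp-rOp≈lOp-rOp isL no⊢)
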